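{- For every integer $q>2$, there exists a rooted $K_q$-booster with rooted density at most $2/(q-2)$.
   Context: A rooted $K_q$-booster is a tuple $(B,\mathcal{B}^{\circ},\mathcal{B}^{\bullet},R)$ where $B$ is a graph; $\mathcal{B}^{\bullet}$ is a $K_q$-decomposition of $B$ (a set of pairwise edge-disjoint copies of $K_q$ in $B$ covering all edges); $R\cong K_q$ with $V(R)\subseteq V(B)$ and $R$ edge-disjoint from $B$; and $\mathcal{B}^{\circ}$ is a $K_q$-decomposition of $B\cup R$ with $R\notin\mathcal{B}^{\circ}$. For a set $\mathcal{H}$ of copies of $K_q$ and a vertex set $R$, the rooted density is $d(\mathcal{H},R):=|\mathcal{H}|\big/\big|\bigcup_{H\in\mathcal{H}}V(H)\setminus R\big|$, and the maximum rooted density is $m(\mathcal{H},R):=\max_{\mathcal{H}'\subseteq\mathcal{H}}d(\mathcal{H}',R)$ (the empty subfamily being taken to have density $0$). The rooted density of the rooted booster $(B,\mathcal{B}^{\circ},\mathcal{B}^{\bullet},R)$ is $\max\{m(\mathcal{B}^{\circ},V(R)),\,m(\mathcal{B}^{\bullet},V(R))\}$. -}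

module Defs where

open import Level using (0ℓ)
open import Data.Nat using (ℕ; _*_; _≤_; _∸_)
open import Data.Fin using (Fin)
open import Data.Fin.Subset using (Subset; _∈_; _∩_; ∁; ⋃; ∣_∣)
open import Data.Product using (Σ; _×_; ∃; ∃-syntax; _,_)
open import Data.Sum using (_⊎_)
open import Data.Empty using (⊥)
open import Data.List using (List; length)
import Data.List.Membership.Propositional as LM
open import Data.List.Relation.Unary.All using (All)
open import Data.List.Relation.Unary.AllPairs using (AllPairs)
open import Data.List.Relation.Binary.Sublist.Propositional using (_⊆_)
open import Relation.Nullary using (¬_)
open import Relation.Binary.PropositionalEquality using (_≡_; _≢_)

record Graph (n : ℕ) : Set₁ where
  field
    Adj    : Fin n → Fin n → Set
    sym    : ∀ {u v} → Adj u v → Adj v u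
    irrefl : ∀ u → ¬ Adj u u
open Graph public

CliqueEdge : ∀ {n} → Subset n → Fin n → Fin n → Set
CliqueEdge S u v = u ∈ S × v ∈ S × u ≢ v

_∪K_ : ∀ {n} → Graph n → Subset n → Graph n
G ∪K S = record
  { Adj    = λ u v → Adj G u v ⊎ CliqueEdge S u v
  ; sym    = λ { (Data.Sum.inj₁ e) → Data.Sum.inj₁ (sym G e)
               ; (Data.Sum.inj₂ (a , b , d)) → Data.Sum.inj₂ (b , a , λ eq → d (Relation.Binary.PropositionalEquality.sym eq)) }
  ; irrefl = λ { u (Data.Sum.inj₁ e) → irrefl G u e
               ; u (Data.Sum.inj₂ (_ , _ , d)) → d Relation.Binary.PropositionalEquality.refl }
  }

IsKqCopyIn : ∀ {n} → ℕ → Graph n → Subset n → Set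
IsKqCopyIn q G H = (∣ H ∣ ≡ q) × (∀ u v → CliqueEdge H u v → Adj G u v)

EdgeDisjoint : ∀ {n} → Subset n → Subset n → Set
EdgeDisjoint H H' = ∀ u v → CliqueEdge H u v → CliqueEdge H' u v → ⊥

-- A K_q-decomposition of G: a set (list of pairwise edge-disjoint, hence distinct,
-- copies) of copies of K_q in G covering every edge of G.
IsKqDecomposition : ∀ {n} → ℕ → Graph n → List (Subset n) → Set
IsKqDecomposition q G 𝓗 =
  All (IsKqCopyIn q G) 𝓗
  × AllPairs EdgeDisjoint 𝓗
  × (∀ u v → Adj G u v → ∃[ H ] (H LM.∈ 𝓗 × CliqueEdge H u v))

-- m(𝓗, R) ≤ a / b, i.e. every subfamily 𝓗' ⊆ 𝓗 has rooted density
-- |𝓗'| / |⋃ V(H) ∖ R| ≤ a / b (cross-multiplied; empty subfamily gives 0 ≤ ..).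
MaxRootedDensity≤ : ∀ {n} → List (Subset n) → Subset n → ℕ → ℕ → Set
MaxRootedDensity≤ 𝓗 R a b =
  ∀ (𝓗' : List (Subset _)) → 𝓗' ⊆ 𝓗 → length 𝓗' * b ≤ a * ∣ ⋃ 𝓗' ∩ ∁ R ∣

record RootedBooster (q n : ℕ) : Set₁ where
  field
    B       : Graph n
    Bcirc   : List (Subset n)
    Bbullet : List (Subset n)
    R       : Subset n
    R-size      : ∣ R ∣ ≡ q
    R-disjoint  : ∀ u v → CliqueEdge R u v → ¬ Adj B u v
    Bbullet-dec : IsKqDecomposition q B Bbullet
    Bcirc-dec   : IsKqDecomposition q (B ∪K R) Bcirc
    R∉Bcirc     : ¬ (R LM.∈ Bcirc)
open RootedBooster public

RootedDensity≤ : ∀ {q n} → RootedBooster q n → ℕ → ℕ → Set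
RootedDensity≤ 𝓑 a b =
  MaxRootedDensity≤ (Bcirc 𝓑) (R 𝓑) a b × MaxRootedDensity≤ (Bbullet 𝓑) (R 𝓑) a b

{-# OPTIONS --safe #-}

-- The booster has q² matrix vertices mat a b, q further vertices ext a, and for each kind
-- (diagonal or external) and each pair u < v a gadget: a (q−1)×(q−1) grid of cells whose rows
-- and columns, each completed by a hub vertex, are copies of K_q.  The root R is the diagonal
-- {mat a a | a}.  B° and B• use the same rows and columns but exchange their two hubs, and line 0
-- of either axis, which misses the corner cell, takes one more (spare) hub.  Besides, B° contains
-- the matrix rows {mat u t | t} and {ext a | a}, and B• the rows {ext u} ∪ {mat u t | t ≠ u}, with
-- R in the role of {ext a | a}.  Every edge of a clique on one side lies in a clique of the other
-- side (or in R): an edge at a cell stays inside the cell's row or column, and the finitely many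
-- kinds of hub–hub edges are matched up with line 0 of a gadget, a matrix row, {ext a | a} or R.
-- Each side is edge-disjoint because a cell lies only in its row and its column, and a pair of
-- hubs determines the clique containing it.
--
-- Every clique has q − 2 private non-root vertices (positions 2, …, q − 1 of its enumeration),
-- and cliques of the same class (columns, or everything else) have disjoint private parts.  Hence
-- any h cliques span at least h (q − 2) / 2 non-root vertices: the rooted density is 2 / (q − 2).

module Submission where

open import Defs
open import Data.Nat using (ℕ; _<_; _∸_)
open import Data.Product using (Σ; ∃-syntax; _×_)

open import Level using (0ℓ)
open import Data.Bool using (Bool; true; false; if_then_else_)
open import Data.Bool.Properties using (¬-not) renaming (_≟_ to _≟ᵇ_)
open import Data.Empty using (⊥-elim)
open import Data.Nat using (zero; suc; _+_; _*_; _≤_; s≤s)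
open import Data.Nat.Properties using (+-suc; +-identityʳ; *-identityʳ; *-distribʳ-+; +-mono-≤; module ≤-Reasoning)
open import Data.Fin as F using (Fin; zero; suc; punchIn)
import Data.Fin.Properties as FP
open import Data.Fin.Properties using (+↔⊎; *↔×)
open import Data.Fin.Subset using (Subset; inside; outside; _∈_; _∉_; _⊆_; _∪_; _∩_; ∁; ⋃; ⁅_⁆; ∣_∣)
open import Data.Fin.Subset.Properties
  using (x∈p∪q⁺; x∈p∪q⁻; x∈p∩q⁺; x∉p⇒x∈∁p; x∈⁅x⁆; x∈⁅y⁆⇒x≡y; ∉⊥; ∣⊥∣≡0; ∣⁅x⁆∣≡1; p⊆q⇒∣p∣≤∣q∣)
open import Data.Vec using ([]; _∷_; here; there)
open import Data.Product using (_,_; proj₁; proj₂; uncurry)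
open import Data.Product.Function.NonDependent.Propositional using (_×-↔_)
open import Data.Sum using (_⊎_; inj₁; inj₂)
open import Data.Sum.Function.Propositional using (_⊎-↔_)
open import Data.Unit using (⊤; tt)
open import Data.List
  using (List; []; _∷_; _++_; length; map; filter; tabulate; allFin; cartesianProduct; cartesianProductWith)
open import Data.List.Properties using (length-map; length-tabulate)
open import Data.List.Membership.Propositional using (find; lose) renaming (_∈_ to _∈ₗ_)
open import Data.List.Membership.Propositional.Properties
  using (∈-++⁺ˡ; ∈-++⁺ʳ; ∈-++⁻; ∈-map⁺; ∈-map⁻; ∈-allFin; ∈-cartesianProduct⁺;
         ∈-cartesianProductWith⁺; ∈-cartesianProductWith⁻; ∈-filter⁺; ∈-filter⁻)
open import Data.List.Relation.Unary.All as All using (All; []; _∷_)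
import Data.List.Relation.Unary.All.Properties as AllP
open import Data.List.Relation.Unary.All.Properties using (all-filter)
open import Data.List.Relation.Unary.Any using (Any; here; there)
import Data.List.Relation.Unary.Any.Properties as AnyP
open import Data.List.Relation.Unary.AllPairs as AllPairs using (AllPairs; []; _∷_)
import Data.List.Relation.Unary.AllPairs.Properties as AllPairsP
open import Data.List.Relation.Unary.Unique.Propositional using (Unique)
import Data.List.Relation.Unary.Unique.Propositional.Properties as UniqueP
open import Data.List.Relation.Binary.Disjoint.Propositional using () renaming (Disjoint to ListDisjoint)
open import Data.List.Relation.Binary.Sublist.Propositional as Sublist
  using (_∷ʳ_; _∷_) renaming (_⊆_ to _⊑_; [] to []ˢ)
open import Data.List.Relation.Binary.Sublist.Propositional.Properties using (All-resp-⊆; filter-⊆)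
open import Function using (_∘_; Injective; _↔_; Inverse)
open import Function.Construct.Composition using (_↔-∘_)
open import Function.Properties.Inverse using (↔-refl)
open import Relation.Binary using (Rel)
open import Relation.Binary.Definitions using (tri<; tri≈; tri>)
open import Relation.Binary.PropositionalEquality as ≡
  using (_≡_; _≢_; ≢-sym; refl; trans; cong; cong₂; module ≡-Reasoning)
open import Relation.Nullary using (¬_; Dec; yes; no; does; ¬?; _×-dec_)
open import Relation.Nullary.Decidable using (dec-true; dec-false)
open import Relation.Unary using (Pred; Decidable)
open import Relation.Unary.Properties using (∁?)

private
  variable
    n k t : ℕ
    A C : Set

Disjoint : Subset n → Subset n → Set
Disjoint p q = ∀ {x} → x ∈ p → x ∉ q

∣p∪q∣≡∣p∣+∣q∣ : ∀ (p q : Subset n) → Disjoint p q → ∣ p ∪ q ∣ ≡ ∣ p ∣ + ∣ q ∣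
∣p∪q∣≡∣p∣+∣q∣ []      []      _   = refl
∣p∪q∣≡∣p∣+∣q∣ (x ∷ p) (y ∷ q) p#q with ∣p∪q∣≡∣p∣+∣q∣ p q (λ x∈p → p#q (there x∈p) ∘ there)
∣p∪q∣≡∣p∣+∣q∣ (inside  ∷ p) (inside  ∷ q) p#q | _  = ⊥-elim (p#q here here)
∣p∪q∣≡∣p∣+∣q∣ (inside  ∷ p) (outside ∷ q) p#q | ih = cong suc ih
∣p∪q∣≡∣p∣+∣q∣ (outside ∷ p) (inside  ∷ q) p#q | ih = trans (cong suc ih) (≡.sym (+-suc _ _))
∣p∪q∣≡∣p∣+∣q∣ (outside ∷ p) (outside ∷ q) p#q | ih = ih

x∈⋃⁺ : ∀ {x : Fin n} {ps} → Any (x ∈_) ps → x ∈ ⋃ ps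
x∈⋃⁺ {ps = p ∷ ps} (here x∈p)   = x∈p∪q⁺ (inj₁ x∈p)
x∈⋃⁺ {ps = p ∷ ps} (there x∈ps) = x∈p∪q⁺ (inj₂ (x∈⋃⁺ x∈ps))

x∈⋃⁻ : ∀ {x : Fin n} ps → x ∈ ⋃ ps → Any (x ∈_) ps
x∈⋃⁻ []       x∈⊥ = ⊥-elim (∉⊥ x∈⊥)
x∈⋃⁻ (p ∷ ps) x∈∪ with x∈p∪q⁻ p (⋃ ps) x∈∪
... | inj₁ x∈p  = here x∈p
... | inj₂ x∈ps = there (x∈⋃⁻ ps x∈ps)

∣⋃∣≡length*t : ∀ {ps : List (Subset n)} → All (λ p → ∣ p ∣ ≡ t) ps → AllPairs Disjoint ps →
               ∣ ⋃ ps ∣ ≡ length ps * t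
∣⋃∣≡length*t {n = n} {ps = []} [] [] = ∣⊥∣≡0 n
∣⋃∣≡length*t {ps = p ∷ ps} (∣p∣ ∷ ∣ps∣) (p#ps ∷ ps#) = begin
  ∣ p ∪ ⋃ ps ∣         ≡⟨ ∣p∪q∣≡∣p∣+∣q∣ p (⋃ ps) p#⋃ps ⟩
  ∣ p ∣ + ∣ ⋃ ps ∣     ≡⟨ cong₂ _+_ ∣p∣ (∣⋃∣≡length*t ∣ps∣ ps#) ⟩
  _ + length ps * _    ∎
  where
  open ≡-Reasoning
  p#⋃ps : Disjoint p (⋃ ps)
  p#⋃ps x∈p x∈⋃ps = All.lookupWith (λ p#p′ → p#p′ x∈p) p#ps (x∈⋃⁻ ps x∈⋃ps)

∈-⋃-map⁺ : ∀ {I : Set} (T : I → Subset n) {i is x} → i ∈ₗ is → x ∈ T i → x ∈ ⋃ (map T is)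
∈-⋃-map⁺ T i∈is x∈Ti = x∈⋃⁺ (AnyP.map⁺ (lose i∈is x∈Ti))

∈-⋃-map⁻ : ∀ {I : Set} (T : I → Subset n) is {x} → x ∈ ⋃ (map T is) → ∃[ i ] (i ∈ₗ is × x ∈ T i)
∈-⋃-map⁻ T is x∈⋃ = find (AnyP.map⁻ (x∈⋃⁻ (map T is) x∈⋃))

image : (Fin k → Fin n) → Subset n
image f = ⋃ (tabulate (⁅_⁆ ∘ f))

∈-image⁺ : ∀ (f : Fin k → Fin n) i → f i ∈ image f
∈-image⁺ f i = x∈⋃⁺ (AnyP.tabulate⁺ i (x∈⁅x⁆ (f i)))

∈-image⁻ : ∀ (f : Fin k → Fin n) {x} → x ∈ image f → ∃[ i ] f i ≡ x
∈-image⁻ f x∈fk with AnyP.tabulate⁻ (x∈⋃⁻ _ x∈fk)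
... | i , x∈⁅fi⁆ = i , ≡.sym (x∈⁅y⁆⇒x≡y (f i) x∈⁅fi⁆)

∣image∣≡k : ∀ (f : Fin k → Fin n) → Injective _≡_ _≡_ f → ∣ image f ∣ ≡ k
∣image∣≡k {k} f f-inj = begin
  ∣ image f ∣                      ≡⟨ ∣⋃∣≡length*t (AllP.tabulate⁺ (∣⁅x⁆∣≡1 ∘ f))
                                                    (AllPairsP.tabulate⁺ singletons-disjoint) ⟩
  length (tabulate (⁅_⁆ ∘ f)) * 1  ≡⟨ *-identityʳ _ ⟩
  length (tabulate (⁅_⁆ ∘ f))      ≡⟨ length-tabulate _ ⟩
  k                                ∎
  where
  open ≡-Reasoning
  singletons-disjoint : ∀ {i j} → i ≢ j → Disjoint ⁅ f i ⁆ ⁅ f j ⁆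
  singletons-disjoint i≢j x∈fi x∈fj = i≢j (f-inj (trans (≡.sym (x∈⁅y⁆⇒x≡y _ x∈fi)) (x∈⁅y⁆⇒x≡y _ x∈fj)))

⊑-map⁻ : ∀ (f : A → C) {ys} xs → ys ⊑ map f xs → ∃[ ws ] (ws ⊑ xs × ys ≡ map f ws)
⊑-map⁻ f []       []ˢ = [] , []ˢ , refl
⊑-map⁻ f (x ∷ xs) (_ ∷ʳ τ) with ⊑-map⁻ f xs τ
... | ws , ws⊑xs , refl = ws , x ∷ʳ ws⊑xs , refl
⊑-map⁻ f (x ∷ xs) (refl ∷ τ) with ⊑-map⁻ f xs τ
... | ws , ws⊑xs , refl = x ∷ ws , refl ∷ ws⊑xs , refl

AllPairs-resp-⊑ : ∀ {ℛ : Rel A 0ℓ} {xs ys} → ys ⊑ xs → AllPairs ℛ xs → AllPairs ℛ ys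
AllPairs-resp-⊑ []ˢ        []          = []
AllPairs-resp-⊑ (_ ∷ʳ τ)   (_ ∷ ℛxs)   = AllPairs-resp-⊑ τ ℛxs
AllPairs-resp-⊑ (refl ∷ τ) (ℛx ∷ ℛxs) = All-resp-⊆ τ ℛx ∷ AllPairs-resp-⊑ τ ℛxs

All⇒AllPairs : ∀ {P : Pred A 0ℓ} {ℛ : Rel A 0ℓ} → (∀ {x y} → P x → P y → ℛ x y) →
               ∀ {xs} → All P xs → AllPairs ℛ xs
All⇒AllPairs f []         = []
All⇒AllPairs f (px ∷ pxs) = All.map (f px) pxs ∷ All⇒AllPairs f pxs

length-filter-∁ : ∀ {P : Pred A 0ℓ} (P? : Decidable P) xs →
                  length (filter P? xs) + length (filter (∁? P?) xs) ≡ length xs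
length-filter-∁ P? []       = refl
length-filter-∁ P? (x ∷ xs) with P? x
... | yes _ = cong suc (length-filter-∁ P? xs)
... | no _  = trans (+-suc _ _) (cong suc (length-filter-∁ P? xs))

Unique⇒AllPairs : ∀ {P : Pred A 0ℓ} {ℛ : Rel A 0ℓ} → (∀ {x y} → P x → P y → x ≢ y → ℛ x y) →
                  ∀ {xs} → All P xs → Unique xs → AllPairs ℛ xs
Unique⇒AllPairs f Pxs xs! = AllPairs.zipWith (λ ((Px , Py) , x≢y) → f Px Py x≢y) (All⇒AllPairs _,_ Pxs , xs!)

-- Graphs given by their cliques

cliqueGraph : List (Subset n) → Graph n
cliqueGraph 𝓗 = record
  { Adj    = λ x y → ∃[ H ] (H ∈ₗ 𝓗 × CliqueEdge H x y)
  ; sym    = λ (H , H∈𝓗 , x∈H , y∈H , x≢y) → H , H∈𝓗 , y∈H , x∈H , ≢-sym x≢y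
  ; irrefl = λ x (_ , _ , _ , _ , x≢x) → x≢x refl
  }

cliqueGraph-decomposition : ∀ {𝓗 : List (Subset n)} → All (λ H → ∣ H ∣ ≡ k) 𝓗 → AllPairs EdgeDisjoint 𝓗 →
                            IsKqDecomposition k (cliqueGraph 𝓗) 𝓗
cliqueGraph-decomposition ∣𝓗∣ 𝓗# =
  All.tabulate (λ {H} H∈𝓗 → All.lookup ∣𝓗∣ H∈𝓗 , λ _ _ e → H , H∈𝓗 , e) , 𝓗# , λ _ _ adj → adj

-- Rooted density through private parts

module _ {I : Set} (S T : I → Subset n) (root : Subset n) where

  length*t≤∣⋃∖root∣ : ∀ {vs ws} → vs ⊑ ws →
    All (λ i → T i ⊆ S i) vs → All (λ i → Disjoint (T i) root) vs → All (λ i → ∣ T i ∣ ≡ t) vs →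
    AllPairs (λ i j → Disjoint (T i) (T j)) vs →
    length vs * t ≤ ∣ ⋃ (map S ws) ∩ ∁ root ∣
  length*t≤∣⋃∖root∣ {t} {vs} {ws} vs⊑ws T⊆S T#root ∣T∣ T# = begin
    length vs * t          ≡⟨ cong (_* t) (length-map T vs) ⟨
    length (map T vs) * t  ≡⟨ ∣⋃∣≡length*t (AllP.map⁺ ∣T∣) (AllPairsP.map⁺ T#) ⟨
    ∣ ⋃ (map T vs) ∣       ≤⟨ p⊆q⇒∣p∣≤∣q∣ ⋃T⊆⋃S∖root ⟩
    ∣ ⋃ (map S ws) ∩ ∁ root ∣ ∎
    where
    open ≤-Reasoning
    ⋃T⊆⋃S∖root : ⋃ (map T vs) ⊆ ⋃ (map S ws) ∩ ∁ root
    ⋃T⊆⋃S∖root x∈⋃T with ∈-⋃-map⁻ T vs x∈⋃T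
    ... | i , i∈vs , x∈Ti = x∈p∩q⁺ (∈-⋃-map⁺ S (Sublist.lookup vs⊑ws i∈vs) (All.lookup T⊆S i∈vs x∈Ti) ,
                                    x∉p⇒x∈∁p (All.lookup T#root i∈vs x∈Ti))

  maxRootedDensity≤2/t : ∀ (class : I → Bool) xs →
    All (λ i → T i ⊆ S i) xs → All (λ i → Disjoint (T i) root) xs → All (λ i → ∣ T i ∣ ≡ t) xs →
    AllPairs (λ i j → class i ≡ class j → Disjoint (T i) (T j)) xs →
    MaxRootedDensity≤ (map S xs) root 2 t
  maxRootedDensity≤2/t {t} class xs T⊆S T#root ∣T∣ T# 𝓗 𝓗⊑ with ⊑-map⁻ S xs 𝓗⊑
  ... | ws , ws⊑xs , refl = begin
    length (map S ws) * t                ≡⟨ cong (_* t) (length-map S ws) ⟩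
    length ws * t                        ≡⟨ cong (_* t) (length-filter-∁ true? ws) ⟨
    (length trues + length falses) * t   ≡⟨ *-distribʳ-+ t (length trues) _ ⟩
    length trues * t + length falses * t ≤⟨ +-mono-≤ (bound (filter-⊆ true? ws) truesSame)
                                                     (bound (filter-⊆ (∁? true?) ws) falsesSame) ⟩
    ∣ U ∣ + ∣ U ∣                        ≡⟨ cong (∣ U ∣ +_) (+-identityʳ _) ⟨
    2 * ∣ U ∣                            ∎
    where
    open ≤-Reasoning
    U = ⋃ (map S ws) ∩ ∁ root
    true? : Decidable (λ i → class i ≡ true)
    true? i = class i ≟ᵇ true
    trues  = filter true? ws
    falses = filter (∁? true?) ws
    truesSame : AllPairs (λ i j → class i ≡ class j) trues
    truesSame = All⇒AllPairs (λ ci cj → trans ci (≡.sym cj)) (all-filter true? ws)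
    falsesSame : AllPairs (λ i j → class i ≡ class j) falses
    falsesSame = All⇒AllPairs (λ ci cj → trans (¬-not ci) (≡.sym (¬-not cj))) (all-filter (∁? true?) ws)
    bound : ∀ {vs} → vs ⊑ ws → AllPairs (λ i j → class i ≡ class j) vs → length vs * t ≤ ∣ U ∣
    bound vs⊑ws same =
      length*t≤∣⋃∖root∣ vs⊑ws (All-resp-⊆ vs⊑xs T⊆S) (All-resp-⊆ vs⊑xs T#root) (All-resp-⊆ vs⊑xs ∣T∣)
        (AllPairs.zipWith (λ (T# , same) {x} → T# same {x}) (AllPairs-resp-⊑ vs⊑xs T# , same))
      where vs⊑xs = Sublist.⊆-trans vs⊑ws ws⊑xs

-- The construction

module Construction (s : ℕ) where

  q : ℕ
  q = suc (suc s)

  data Kind : Set where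
    diagonal external : Kind

  data Axis : Set where
    row col : Axis

  flip : Axis → Axis
  flip row = col
  flip col = row

  data Side : Set where
    circ bullet : Side

  opposite : Side → Side
  opposite circ   = bullet
  opposite bullet = circ

  record Gadget : Set where
    constructor gadget
    field
      kind   : Kind
      lo hi  : Fin q

  data Hub : Set where
    mat : Fin q → Fin q → Hub
    ext : Fin q → Hub

  data Vertex : Set where
    hub  : Hub → Vertex
    cell : Gadget → Fin (suc s) → Fin (suc s) → Vertex

  data Clique : Set where
    line : Gadget → Axis → Fin (suc s) → Clique
    mrow : Fin q → Clique
    apex : Clique

  centre spare : Axis → Gadget → Hub
  centre row (gadget diagonal u v) = mat v v
  centre row (gadget external u v) = ext v
  centre col (gadget _        u v) = mat u v
  spare  row (gadget diagonal u v) = mat u u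
  spare  row (gadget external u v) = mat v u
  spare  col (gadget diagonal u v) = mat v u
  spare  col (gadget external u v) = ext u

  lineHub : Side → Axis → Gadget → Hub
  lineHub circ   ax = centre ax
  lineHub bullet ax = centre (flip ax)

  gridCell : Axis → Gadget → Fin (suc s) → Fin (suc s) → Vertex
  gridCell row g j p = cell g j p
  gridCell col g j p = cell g p j

  lineVertex : Hub → Hub → (Fin (suc s) → Vertex) → Fin (suc s) → Fin q → Vertex
  lineVertex h a f j       zero          = hub h
  lineVertex h a f zero    (suc zero)    = hub a
  lineVertex h a f zero    (suc (suc p)) = f (suc p)
  lineVertex h a f (suc i) (suc p)       = f p

  mrowHub : Side → Fin q → Fin q → Hub
  mrowHub _      u (suc d) = mat u (punchIn u d)
  mrowHub circ   u zero    = mat u u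
  mrowHub bullet u zero    = ext u

  apexHub : Side → Fin q → Hub
  apexHub circ   a = ext a
  apexHub bullet a = mat a a

  vertex : Side → Clique → Fin q → Vertex
  vertex sd (line g ax j) = lineVertex (lineHub sd ax g) (spare ax g) (gridCell ax g j) j
  vertex sd (mrow u)      = hub ∘ mrowHub sd u
  vertex sd apex          = hub ∘ apexHub sd

  _∈[_]_ : Vertex → Side → Clique → Set
  w ∈[ sd ] i = ∃[ p ] vertex sd i p ≡ w

  -- Gadgets with lo ≥ hi take no part in the booster; their cells are isolated vertices.
  Valid : Clique → Set
  Valid (line (gadget _ u v) _ _) = u F.< v
  Valid (mrow _)                  = ⊤
  Valid apex                      = ⊤

  valid? : Decidable Valid
  valid? (line (gadget _ u v) _ _) = u F.<? v
  valid? (mrow _)                  = yes tt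
  valid? apex                      = yes tt

  hub-injective : ∀ {x y} → hub x ≡ hub y → x ≡ y
  hub-injective refl = refl

  mat-injectiveˡ : ∀ {a b c d} → hub (mat a b) ≡ hub (mat c d) → a ≡ c
  mat-injectiveˡ refl = refl

  mat-injectiveʳ : ∀ {a b c d} → hub (mat a b) ≡ hub (mat c d) → b ≡ d
  mat-injectiveʳ refl = refl

  punchIn≢ : ∀ (u : Fin q) d → u ≢ punchIn u d
  punchIn≢ u d = ≢-sym (FP.punchInᵢ≢i u d)

  centre≢spare : ∀ ax ax′ k {u v} → u ≢ v → centre ax (gadget k u v) ≢ spare ax′ (gadget k u v)
  centre≢spare row row diagonal u≢v refl = u≢v refl
  centre≢spare row row external u≢v ()
  centre≢spare row col diagonal u≢v refl = u≢v refl
  centre≢spare row col external u≢v refl = u≢v refl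
  centre≢spare col row diagonal u≢v refl = u≢v refl
  centre≢spare col row external u≢v refl = u≢v refl
  centre≢spare col col diagonal u≢v refl = u≢v refl
  centre≢spare col col external u≢v ()

  centre-row≢col : ∀ k {u v} → u ≢ v → centre row (gadget k u v) ≢ centre col (gadget k u v)
  centre-row≢col diagonal u≢v refl = u≢v refl
  centre-row≢col external u≢v ()

  spare-row≢col : ∀ k {u v} → u ≢ v → spare row (gadget k u v) ≢ spare col (gadget k u v)
  spare-row≢col diagonal u≢v refl = u≢v refl
  spare-row≢col external u≢v ()

  lineHub≢spare : ∀ sd ax ax′ k {u v} → u ≢ v → lineHub sd ax (gadget k u v) ≢ spare ax′ (gadget k u v)
  lineHub≢spare circ   ax = centre≢spare ax
  lineHub≢spare bullet ax = centre≢spare (flip ax)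

  lineHub-row≢col : ∀ sd k {u v} → u ≢ v → lineHub sd row (gadget k u v) ≢ lineHub sd col (gadget k u v)
  lineHub-row≢col circ   k u≢v = centre-row≢col k u≢v
  lineHub-row≢col bullet k u≢v = centre-row≢col k u≢v ∘ ≡.sym

  lineHub-flip : ∀ sd ax g → lineHub (opposite sd) (flip ax) g ≡ lineHub sd ax g
  lineHub-flip circ   row g = refl
  lineHub-flip circ   col g = refl
  lineHub-flip bullet row g = refl
  lineHub-flip bullet col g = refl

  gridCell-flip : ∀ ax g j p → gridCell (flip ax) g p j ≡ gridCell ax g j p
  gridCell-flip row g j p = refl
  gridCell-flip col g j p = refl

  gridCell≢hub : ∀ ax g j {p x} → gridCell ax g j p ≢ hub x
  gridCell≢hub row g j ()
  gridCell≢hub col g j ()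

  gridCell-injective : ∀ ax g j → Injective _≡_ _≡_ (gridCell ax g j)
  gridCell-injective row g j refl = refl
  gridCell-injective col g j refl = refl

  module _ {h a : Hub} {f : Fin (suc s) → Vertex} where

    data LineView (j : Fin (suc s)) (w : Vertex) : Set where
      atHub   : w ≡ hub h → LineView j w
      atSpare : j ≡ zero → w ≡ hub a → LineView j w
      atCell  : ∀ p → (j ≡ zero → p ≢ zero) → w ≡ f p → LineView j w

    lineView : ∀ {j w} → ∃[ p ] lineVertex h a f j p ≡ w → LineView j w
    lineView {j}     (zero , refl)        = atHub refl
    lineView {zero}  (suc zero , refl)    = atSpare refl refl
    lineView {zero}  (suc (suc p) , refl) = atCell (suc p) (λ _ ()) refl
    lineView {suc i} (suc p , refl)       = atCell p (λ ()) refl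

    cell∈line : ∀ j p → (j ≡ zero → p ≢ zero) → ∃[ r ] lineVertex h a f j r ≡ f p
    cell∈line zero    zero    j≡0⇒p≢0 = ⊥-elim (j≡0⇒p≢0 refl refl)
    cell∈line zero    (suc p) _       = suc (suc p) , refl
    cell∈line (suc i) p       _       = suc p , refl

    lineVertex-injective : ∀ j → h ≢ a → (∀ {p x} → f p ≢ hub x) → Injective _≡_ _≡_ f →
                           Injective _≡_ _≡_ (lineVertex h a f j)
    lineVertex-injective (suc i) _   _    _ {zero}        {zero}        _ = refl
    lineVertex-injective (suc i) _   f≢h  _ {zero}        {suc y}       e = ⊥-elim (f≢h (≡.sym e))
    lineVertex-injective (suc i) _   f≢h  _ {suc x}       {zero}        e = ⊥-elim (f≢h e)
    lineVertex-injective (suc i) _   _    f-inj {suc x}   {suc y}       e = cong suc (f-inj e)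
    lineVertex-injective zero    _   _    _ {zero}        {zero}        _ = refl
    lineVertex-injective zero    h≢a _    _ {zero}        {suc zero}    refl = ⊥-elim (h≢a refl)
    lineVertex-injective zero    _   f≢h  _ {zero}        {suc (suc y)} e = ⊥-elim (f≢h (≡.sym e))
    lineVertex-injective zero    h≢a _    _ {suc zero}    {zero}        refl = ⊥-elim (h≢a refl)
    lineVertex-injective zero    _   _    _ {suc zero}    {suc zero}    _ = refl
    lineVertex-injective zero    _   f≢h  _ {suc zero}    {suc (suc y)} e = ⊥-elim (f≢h (≡.sym e))
    lineVertex-injective zero    _   f≢h  _ {suc (suc x)} {zero}        e = ⊥-elim (f≢h e)
    lineVertex-injective zero    _   f≢h  _ {suc (suc x)} {suc zero}    e = ⊥-elim (f≢h e)
    lineVertex-injective zero    _   _    f-inj {suc (suc x)} {suc (suc y)} e = cong suc (f-inj e)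

  vertex-injective : ∀ sd i → Valid i → Injective _≡_ _≡_ (vertex sd i)
  vertex-injective sd (line (gadget k u v) ax j) u<v =
    lineVertex-injective j (lineHub≢spare sd ax ax k (FP.<⇒≢ u<v))
      (gridCell≢hub ax _ j) (gridCell-injective ax _ j)
  vertex-injective sd     (mrow u) _ {zero}  {zero}  _ = refl
  vertex-injective circ   (mrow u) _ {zero}  {suc d} e = ⊥-elim (punchIn≢ u d (mat-injectiveʳ e))
  vertex-injective circ   (mrow u) _ {suc d} {zero}  e = ⊥-elim (punchIn≢ u d (≡.sym (mat-injectiveʳ e)))
  vertex-injective bullet (mrow u) _ {zero}  {suc d} ()
  vertex-injective bullet (mrow u) _ {suc d} {zero}  ()
  vertex-injective sd     (mrow u) _ {suc d} {suc d′} e =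
    cong suc (FP.punchIn-injective u d d′ (mat-injectiveʳ e))
  vertex-injective circ   apex _ refl = refl
  vertex-injective bullet apex _ refl = refl

  cell∈⇒line : ∀ {sd i g r c} → cell g r c ∈[ sd ] i → i ≡ line g row r ⊎ i ≡ line g col c
  cell∈⇒line {i = line g row j} w∈i with lineView w∈i
  ... | atCell p _ refl = inj₁ refl
  cell∈⇒line {i = line g col j} w∈i with lineView w∈i
  ... | atCell p _ refl = inj₂ refl
  cell∈⇒line {i = mrow u} (zero , ())
  cell∈⇒line {i = mrow u} (suc d , ())
  cell∈⇒line {circ}   {apex} (_ , ())
  cell∈⇒line {bullet} {apex} (_ , ())

  row∩col : ∀ {sd k u v r c w} → u ≢ v → let g = gadget k u v in
            w ∈[ sd ] line g row r → w ∈[ sd ] line g col c → w ≡ cell g r c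
  row∩col {sd} {k} u≢v w∈r w∈c with lineView w∈r | lineView w∈c
  ... | atHub refl     | atHub e     = ⊥-elim (lineHub-row≢col sd k u≢v (hub-injective e))
  ... | atHub refl     | atSpare _ e = ⊥-elim (lineHub≢spare sd row col k u≢v (hub-injective e))
  ... | atSpare _ refl | atHub e     = ⊥-elim (lineHub≢spare sd col row k u≢v (≡.sym (hub-injective e)))
  ... | atSpare _ refl | atSpare _ e = ⊥-elim (spare-row≢col k u≢v (hub-injective e))
  ... | atCell _ _ refl | atCell _ _ refl = refl

  sortedGadget : Kind → Fin q → Fin q → Gadget
  sortedGadget k a b = if does (a F.<? b) then gadget k a b else gadget k b a

  cornerLine : Kind → Fin q → Fin q → Clique
  cornerLine k a b = if does (a F.<? b) then line (gadget k a b) row zero else line (gadget k b a) col zero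

  hubOwner : Side → Hub → Hub → Clique
  hubOwner circ (mat a b) (mat c d) =
    if does (a FP.≟ c) then mrow a
    else if does (a FP.≟ b) then line (sortedGadget diagonal a c) row zero
    else line (sortedGadget diagonal a c) col zero
  hubOwner circ (ext _)   (ext _)   = apex
  hubOwner circ (ext a)   (mat _ c) = cornerLine external c a
  hubOwner circ (mat _ c) (ext a)   = cornerLine external c a
  hubOwner bullet (mat a b) (mat c d) =
    if does (a FP.≟ c)
      then (if does (a FP.≟ b) then cornerLine diagonal a d
            else if does (c FP.≟ d) then cornerLine diagonal a b
            else mrow a)
    else if does (a FP.≟ b) then apex
    else line (sortedGadget external a c) row zero
  hubOwner bullet (ext a)   (ext b)   = line (sortedGadget external a b) col zero
  hubOwner bullet (ext _)   (mat b _) = mrow b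
  hubOwner bullet (mat b _) (ext _)   = mrow b

  module _ {a b : Fin q} where

    ≟-yes : a ≡ b → does (a FP.≟ b) ≡ true
    ≟-yes = dec-true (a FP.≟ b)

    ≟-no : a ≢ b → does (a FP.≟ b) ≡ false
    ≟-no = dec-false (a FP.≟ b)

    sortedGadget-< : ∀ k → a F.< b → sortedGadget k a b ≡ gadget k a b
    sortedGadget-< k a<b rewrite dec-true (a F.<? b) a<b = refl

    sortedGadget-> : ∀ k → a F.< b → sortedGadget k b a ≡ gadget k a b
    sortedGadget-> k a<b rewrite dec-false (b F.<? a) (FP.<-asym a<b) = refl

    cornerLine-< : ∀ k → a F.< b → cornerLine k a b ≡ line (gadget k a b) row zero
    cornerLine-< k a<b rewrite dec-true (a F.<? b) a<b = refl

    cornerLine-> : ∀ k → a F.< b → cornerLine k b a ≡ line (gadget k a b) col zero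
    cornerLine-> k a<b rewrite dec-false (b F.<? a) (FP.<-asym a<b) = refl

  hubOwner-lineEnds : ∀ sd ax k {u v} → u F.< v → let g = gadget k u v in
    hubOwner sd (lineHub sd ax g) (spare ax g) ≡ line g ax zero ×
    hubOwner sd (spare ax g) (lineHub sd ax g) ≡ line g ax zero
  hubOwner-lineEnds circ row diagonal {u} {v} u<v
    rewrite ≟-no (FP.<⇒≢ u<v) | ≟-no (≢-sym (FP.<⇒≢ u<v)) | ≟-yes {u} refl | ≟-yes {v} refl
          | sortedGadget-< diagonal u<v | sortedGadget-> diagonal u<v = refl , refl
  hubOwner-lineEnds circ row external u<v rewrite cornerLine-< external u<v = refl , refl
  hubOwner-lineEnds circ col diagonal u<v
    rewrite ≟-no (FP.<⇒≢ u<v) | ≟-no (≢-sym (FP.<⇒≢ u<v))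
          | sortedGadget-< diagonal u<v | sortedGadget-> diagonal u<v = refl , refl
  hubOwner-lineEnds circ col external u<v rewrite cornerLine-> external u<v = refl , refl
  hubOwner-lineEnds bullet row diagonal {u} {v} u<v
    rewrite ≟-no (FP.<⇒≢ u<v) | ≟-yes {u} refl | cornerLine-< diagonal u<v = refl , refl
  hubOwner-lineEnds bullet row external u<v
    rewrite ≟-no (FP.<⇒≢ u<v) | ≟-no (≢-sym (FP.<⇒≢ u<v))
          | sortedGadget-< external u<v | sortedGadget-> external u<v = refl , refl
  hubOwner-lineEnds bullet col diagonal {u} {v} u<v
    rewrite ≟-no (≢-sym (FP.<⇒≢ u<v)) | ≟-yes {v} refl | cornerLine-> diagonal u<v = refl , refl
  hubOwner-lineEnds bullet col external u<v
    rewrite sortedGadget-< external u<v | sortedGadget-> external u<v = refl , refl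

  hubOwner-mrow : ∀ sd u {p p′} → p ≢ p′ → hubOwner sd (mrowHub sd u p) (mrowHub sd u p′) ≡ mrow u
  hubOwner-mrow sd     u {zero}  {zero}   p≢p′ = ⊥-elim (p≢p′ refl)
  hubOwner-mrow circ   u {zero}  {suc _}  _ rewrite ≟-yes {u} refl = refl
  hubOwner-mrow circ   u {suc _} {zero}   _ rewrite ≟-yes {u} refl = refl
  hubOwner-mrow circ   u {suc _} {suc _}  _ rewrite ≟-yes {u} refl = refl
  hubOwner-mrow bullet u {zero}  {suc _}  _ = refl
  hubOwner-mrow bullet u {suc _} {zero}   _ = refl
  hubOwner-mrow bullet u {suc d} {suc d′} _
    rewrite ≟-yes {u} refl | ≟-no (punchIn≢ u d) | ≟-no (punchIn≢ u d′) = refl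

  hubOwner-apex : ∀ sd {a b} → a ≢ b → hubOwner sd (apexHub sd a) (apexHub sd b) ≡ apex
  hubOwner-apex circ   a≢b = refl
  hubOwner-apex bullet {a} a≢b rewrite ≟-no a≢b | ≟-yes {a} refl = refl

  hubOwner-correct : ∀ sd i → Valid i → ∀ {h₁ h₂} → h₁ ≢ h₂ → hub h₁ ∈[ sd ] i → hub h₂ ∈[ sd ] i →
                     hubOwner sd h₁ h₂ ≡ i
  hubOwner-correct sd (line (gadget k u v) ax j) u<v h₁≢h₂ h₁∈i h₂∈i with lineView h₁∈i | lineView h₂∈i
  ... | atHub refl       | atHub refl       = ⊥-elim (h₁≢h₂ refl)
  ... | atHub refl       | atSpare refl refl = proj₁ (hubOwner-lineEnds sd ax k u<v)
  ... | atSpare refl refl | atHub refl      = proj₂ (hubOwner-lineEnds sd ax k u<v)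
  ... | atSpare _ refl   | atSpare _ refl   = ⊥-elim (h₁≢h₂ refl)
  ... | atCell _ _ e     | _                = ⊥-elim (gridCell≢hub ax _ j (≡.sym e))
  ... | _                | atCell _ _ e     = ⊥-elim (gridCell≢hub ax _ j (≡.sym e))
  hubOwner-correct sd (mrow u) _ h₁≢h₂ (p , refl) (p′ , refl) = hubOwner-mrow sd u (h₁≢h₂ ∘ cong (mrowHub sd u))
  hubOwner-correct sd apex     _ h₁≢h₂ (a , refl) (b , refl)  = hubOwner-apex sd (h₁≢h₂ ∘ cong (apexHub sd))

  sharedEdge⇒≡ : ∀ sd {i j w₁ w₂} → Valid i → Valid j → w₁ ≢ w₂ →
                 w₁ ∈[ sd ] i → w₂ ∈[ sd ] i → w₁ ∈[ sd ] j → w₂ ∈[ sd ] j → i ≡ j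
  sharedEdge⇒≡ sd {w₁ = cell _ _ _} vi vj w₁≢w₂ w₁∈i w₂∈i w₁∈j w₂∈j =
    throughCell vi (≢-sym w₁≢w₂) w₁∈i w₂∈i w₁∈j w₂∈j
    where
    throughCell : ∀ {i j g r c w} → Valid i → w ≢ cell g r c →
                  cell g r c ∈[ sd ] i → w ∈[ sd ] i → cell g r c ∈[ sd ] j → w ∈[ sd ] j → i ≡ j
    throughCell {i} {j} vi w≢c c∈i w∈i c∈j w∈j with cell∈⇒line {i = i} c∈i | cell∈⇒line {i = j} c∈j
    ... | inj₁ refl | inj₁ refl = refl
    ... | inj₂ refl | inj₂ refl = refl
    ... | inj₁ refl | inj₂ refl = ⊥-elim (w≢c (row∩col {sd} (FP.<⇒≢ vi) w∈i w∈j))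
    ... | inj₂ refl | inj₁ refl = ⊥-elim (w≢c (row∩col {sd} (FP.<⇒≢ vi) w∈j w∈i))
  sharedEdge⇒≡ sd {w₁ = hub _} {w₂ = cell _ _ _} vi vj w₁≢w₂ w₁∈i w₂∈i w₁∈j w₂∈j =
    sharedEdge⇒≡ sd vi vj (≢-sym w₁≢w₂) w₂∈i w₁∈i w₂∈j w₁∈j
  sharedEdge⇒≡ sd {i} {j} {hub _} {hub _} vi vj w₁≢w₂ w₁∈i w₂∈i w₁∈j w₂∈j =
    trans (≡.sym (hubOwner-correct sd i vi h₁≢h₂ w₁∈i w₂∈i)) (hubOwner-correct sd j vj h₁≢h₂ w₁∈j w₂∈j)
    where h₁≢h₂ = w₁≢w₂ ∘ cong hub

  CoveredOn : Side → Vertex → Vertex → Set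
  CoveredOn sd w₁ w₂ = ∃[ j ] (Valid j × w₁ ∈[ sd ] j × w₂ ∈[ sd ] j)

  coveredOn-sym : ∀ {sd w₁ w₂} → CoveredOn sd w₁ w₂ → CoveredOn sd w₂ w₁
  coveredOn-sym (j , vj , w₁∈j , w₂∈j) = j , vj , w₂∈j , w₁∈j

  gridCell∈line : ∀ sd ax g j p → (j ≡ zero → p ≢ zero) → gridCell ax g j p ∈[ sd ] line g ax j
  gridCell∈line sd ax g j p = cell∈line {lineHub sd ax g} {spare ax g} {gridCell ax g j} j p

  mat∈mrow : ∀ sd {u t} → u ≢ t → hub (mat u t) ∈[ sd ] mrow u
  mat∈mrow sd u≢t = suc (F.punchOut u≢t) , cong (hub ∘ mat _) (FP.punchIn-punchOut u≢t)

  lineEnds-covered : ∀ sd ax k {u v} → u F.< v → let g = gadget k u v in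
                     CoveredOn (opposite sd) (hub (lineHub sd ax g)) (hub (spare ax g))
  lineEnds-covered circ row diagonal {u} {v} u<v = apex , _ , (v , refl) , (u , refl)
  lineEnds-covered circ row external u<v = mrow _ , _ , (zero , refl) , mat∈mrow bullet (≢-sym (FP.<⇒≢ u<v))
  lineEnds-covered circ col diagonal u<v =
    line (gadget external _ _) row zero , u<v , (zero , refl) , (suc zero , refl)
  lineEnds-covered circ col external u<v = mrow _ , _ , mat∈mrow bullet (FP.<⇒≢ u<v) , (zero , refl)
  lineEnds-covered bullet row diagonal u<v = mrow _ , _ , mat∈mrow circ (FP.<⇒≢ u<v) , (zero , refl)
  lineEnds-covered bullet row external u<v =
    line (gadget diagonal _ _) col zero , u<v , (zero , refl) , (suc zero , refl)
  lineEnds-covered bullet col diagonal u<v = mrow _ , _ , (zero , refl) , mat∈mrow circ (≢-sym (FP.<⇒≢ u<v))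
  lineEnds-covered bullet col external {u} {v} u<v = apex , _ , (v , refl) , (u , refl)

  hubCell-covered : ∀ sd ax g j p → (j ≡ zero → p ≢ zero) → Valid (line g ax j) →
                    CoveredOn (opposite sd) (hub (lineHub sd ax g)) (gridCell ax g j p)
  hubCell-covered sd ax g j p j≡0⇒p≢0 vg =
    line g (flip ax) p , vg , (zero , cong hub (lineHub-flip sd ax g)) ,
    ≡.subst (_∈[ opposite sd ] line g (flip ax) p) (gridCell-flip ax g j p)
            (gridCell∈line (opposite sd) (flip ax) g p j (λ p≡0 j≡0 → j≡0⇒p≢0 j≡0 p≡0))

  mrowFirst-covered : ∀ sd {u t} → u ≢ t → CoveredOn (opposite sd) (hub (mrowHub sd u zero)) (hub (mat u t))
  mrowFirst-covered sd {u} {t} u≢t with FP.<-cmp u t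
  ... | tri≈ _ u≡t _ = ⊥-elim (u≢t u≡t)
  mrowFirst-covered circ   _ | tri< u<t _ _ = line (gadget diagonal _ _) row zero , u<t , (suc zero , refl) , (zero , refl)
  mrowFirst-covered circ   _ | tri> _ _ t<u = line (gadget diagonal _ _) col zero , t<u , (zero , refl) , (suc zero , refl)
  mrowFirst-covered bullet _ | tri< u<t _ _ = line (gadget external _ _) col zero , u<t , (suc zero , refl) , (zero , refl)
  mrowFirst-covered bullet _ | tri> _ _ t<u = line (gadget external _ _) row zero , t<u , (zero , refl) , (suc zero , refl)

  apex-covered : ∀ sd {a b} → a ≢ b → CoveredOn (opposite sd) (hub (apexHub sd a)) (hub (apexHub sd b))
  apex-covered sd {a} {b} a≢b with FP.<-cmp a b
  ... | tri≈ _ a≡b _ = ⊥-elim (a≢b a≡b)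
  apex-covered circ   _ | tri< a<b _ _ = line (gadget external _ _) col zero , a<b , (suc zero , refl) , (zero , refl)
  apex-covered circ   _ | tri> _ _ b<a = line (gadget external _ _) col zero , b<a , (zero , refl) , (suc zero , refl)
  apex-covered bullet _ | tri< a<b _ _ = line (gadget diagonal _ _) row zero , a<b , (suc zero , refl) , (zero , refl)
  apex-covered bullet _ | tri> _ _ b<a = line (gadget diagonal _ _) row zero , b<a , (zero , refl) , (suc zero , refl)

  edge-covered : ∀ sd i → Valid i → ∀ {w₁ w₂} → w₁ ≢ w₂ → w₁ ∈[ sd ] i → w₂ ∈[ sd ] i →
                 CoveredOn (opposite sd) w₁ w₂
  edge-covered sd (line g@(gadget k u v) ax j) u<v w₁≢w₂ w₁∈i w₂∈i with lineView w₁∈i | lineView w₂∈i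
  ... | atHub refl        | atHub refl         = ⊥-elim (w₁≢w₂ refl)
  ... | atSpare _ refl    | atSpare _ refl     = ⊥-elim (w₁≢w₂ refl)
  ... | atHub refl        | atSpare refl refl  = lineEnds-covered sd ax k u<v
  ... | atSpare refl refl | atHub refl         = coveredOn-sym (lineEnds-covered sd ax k u<v)
  ... | atHub refl        | atCell p p≢ refl   = hubCell-covered sd ax g j p p≢ u<v
  ... | atCell p p≢ refl  | atHub refl         = coveredOn-sym (hubCell-covered sd ax g j p p≢ u<v)
  ... | atSpare refl refl | atCell p p≢ refl   =
    line g ax zero , u<v , (suc zero , refl) , gridCell∈line (opposite sd) ax g zero p p≢
  ... | atCell p p≢ refl  | atSpare refl refl  =
    line g ax zero , u<v , gridCell∈line (opposite sd) ax g zero p p≢ , (suc zero , refl)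
  ... | atCell p p≢ refl  | atCell p′ p′≢ refl =
    line g ax j , u<v , gridCell∈line (opposite sd) ax g j p p≢ , gridCell∈line (opposite sd) ax g j p′ p′≢
  edge-covered sd (mrow u) _ w₁≢w₂ (zero , refl)  (zero , refl)   = ⊥-elim (w₁≢w₂ refl)
  edge-covered sd (mrow u) _ w₁≢w₂ (zero , refl)  (suc d , refl)  = mrowFirst-covered sd (punchIn≢ u d)
  edge-covered sd (mrow u) _ w₁≢w₂ (suc d , refl) (zero , refl)   = coveredOn-sym (mrowFirst-covered sd (punchIn≢ u d))
  edge-covered sd (mrow u) _ w₁≢w₂ (suc d , refl) (suc d′ , refl) = mrow u , _ , (suc d , refl) , (suc d′ , refl)
  edge-covered sd apex     _ w₁≢w₂ (a , refl)     (b , refl)      = apex-covered sd (w₁≢w₂ ∘ cong (hub ∘ apexHub sd))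

  isColumn : Clique → Bool
  isColumn (line _ col _) = true
  isColumn _              = false

  privateVertex : Side → Clique → Fin s → Vertex
  privateVertex sd i p = vertex sd i (suc (suc p))

  privateOwner : Bool → Vertex → Clique
  privateOwner false (cell g r _)    = line g row r
  privateOwner true  (cell g _ c)    = line g col c
  privateOwner _     (hub (mat u _)) = mrow u
  privateOwner _     (hub (ext _))   = apex

  -- The cliques of B° and of B•; on side bullet, apex is the root R itself.
  Listed : Side → Clique → Set
  Listed circ   i = Valid i
  Listed bullet i = Valid i × i ≢ apex

  privateOwner-correct : ∀ sd i → Listed sd i → ∀ p → privateOwner (isColumn i) (privateVertex sd i p) ≡ i
  privateOwner-correct sd     (line g row zero)    _ p = refl
  privateOwner-correct sd     (line g row (suc j)) _ p = refl
  privateOwner-correct sd     (line g col zero)    _ p = refl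
  privateOwner-correct sd     (line g col (suc j)) _ p = refl
  privateOwner-correct sd     (mrow u)             _ p = refl
  privateOwner-correct circ   apex                 _ p = refl
  privateOwner-correct bullet apex (_ , apex≢apex)   p = ⊥-elim (apex≢apex refl)

  privateVertex≢root : ∀ sd i → Listed sd i → ∀ p a → privateVertex sd i p ≢ vertex bullet apex a
  privateVertex≢root sd     (line g ax zero)    _ p a = gridCell≢hub ax g zero
  privateVertex≢root sd     (line g ax (suc j)) _ p a = gridCell≢hub ax g (suc j)
  privateVertex≢root sd     (mrow u)            _ p a e =
    FP.punchInᵢ≢i u (suc p) (trans (mat-injectiveʳ e) (≡.sym (mat-injectiveˡ e)))
  privateVertex≢root circ   apex                _ p a ()
  privateVertex≢root bullet apex (_ , apex≢apex)  p a = ⊥-elim (apex≢apex refl)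

  listed? : ∀ sd → Decidable (Listed sd)
  listed? circ   i = valid? i
  listed? bullet i = valid? i ×-dec ¬? (apex? i)
    where
    apex? : ∀ i → Dec (i ≡ apex)
    apex? (line _ _ _) = no λ ()
    apex? (mrow _)     = no λ ()
    apex? apex         = yes refl

  kinds : List Kind
  kinds = diagonal ∷ external ∷ []

  axes : List Axis
  axes = row ∷ col ∷ []

  allGadgets : List Gadget
  allGadgets = cartesianProductWith (uncurry ∘ gadget) kinds (cartesianProduct (allFin q) (allFin q))

  allLines : List Clique
  allLines = cartesianProductWith (uncurry line) (cartesianProduct allGadgets axes) (allFin (suc s))

  allCliques : List Clique
  allCliques = allLines ++ map mrow (allFin q) ++ apex ∷ []

  ∈-allCliques : ∀ i → i ∈ₗ allCliques
  ∈-allCliques (line (gadget k u v) ax j) =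
    ∈-++⁺ˡ (∈-cartesianProductWith⁺ (uncurry line) (∈-cartesianProduct⁺ g∈ (∈-axes ax)) (∈-allFin j))
    where
    ∈-kinds : ∀ k → k ∈ₗ kinds
    ∈-kinds diagonal = here refl
    ∈-kinds external = there (here refl)
    ∈-axes : ∀ ax → ax ∈ₗ axes
    ∈-axes row = here refl
    ∈-axes col = there (here refl)
    g∈ = ∈-cartesianProductWith⁺ (uncurry ∘ gadget) (∈-kinds k) (∈-cartesianProduct⁺ (∈-allFin u) (∈-allFin v))
  ∈-allCliques (mrow u) = ∈-++⁺ʳ allLines (∈-++⁺ˡ (∈-map⁺ mrow (∈-allFin u)))
  ∈-allCliques apex     = ∈-++⁺ʳ allLines (∈-++⁺ʳ (map mrow (allFin q)) (here refl))

  allCliques-unique : Unique allCliques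
  allCliques-unique = UniqueP.++⁺ lines-unique (UniqueP.++⁺ mrows-unique ([] ∷ []) mrows#apex) lines#rest
    where
    pair-unique : ∀ {A : Set} {x y : A} → x ≢ y → Unique (x ∷ y ∷ [])
    pair-unique x≢y = (x≢y ∷ []) ∷ [] ∷ []
    gadgets-unique : Unique allGadgets
    gadgets-unique = UniqueP.cartesianProductWith⁺ (uncurry ∘ gadget) (λ { refl → refl , refl })
                       (pair-unique λ ()) (UniqueP.cartesianProduct⁺ (UniqueP.allFin⁺ q) (UniqueP.allFin⁺ q))
    lines-unique : Unique allLines
    lines-unique = UniqueP.cartesianProductWith⁺ (uncurry line) (λ { refl → refl , refl })
                     (UniqueP.cartesianProduct⁺ gadgets-unique (pair-unique λ ())) (UniqueP.allFin⁺ (suc s))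
    mrows-unique : Unique (map mrow (allFin q))
    mrows-unique = UniqueP.map⁺ (λ { refl → refl }) (UniqueP.allFin⁺ q)
    mrows#apex : ListDisjoint (map mrow (allFin q)) (apex ∷ [])
    mrows#apex (i∈mrows , here refl) with ∈-map⁻ mrow i∈mrows
    ... | _ , _ , ()
    lines#rest : ListDisjoint allLines (map mrow (allFin q) ++ apex ∷ [])
    lines#rest (i∈lines , i∈rest)
      with ∈-cartesianProductWith⁻ (uncurry line) (cartesianProduct allGadgets axes) (allFin (suc s)) i∈lines
    ... | _ , _ , _ , _ , refl with ∈-++⁻ (map mrow (allFin q)) i∈rest
    ...   | inj₁ i∈mrows with ∈-map⁻ mrow i∈mrows
    ...     | _ , _ , ()
    lines#rest (_ , _) | _ , _ , _ , _ , refl | inj₂ (here ())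

  cliques : Side → List Clique
  cliques sd = filter (listed? sd) allCliques

  ∈-cliques⁺ : ∀ sd i → Listed sd i → i ∈ₗ cliques sd
  ∈-cliques⁺ sd i = ∈-filter⁺ (listed? sd) (∈-allCliques i)

  ∈-cliques⁻ : ∀ sd {i} → i ∈ₗ cliques sd → Listed sd i
  ∈-cliques⁻ sd i∈ = proj₂ (∈-filter⁻ (listed? sd) {xs = allCliques} i∈)

  cliques-unique : ∀ sd → Unique (cliques sd)
  cliques-unique sd = UniqueP.filter⁺ (listed? sd) allCliques-unique

  listed⇒valid : ∀ sd {i} → Listed sd i → Valid i
  listed⇒valid circ   vi       = vi
  listed⇒valid bullet (vi , _) = vi

-- The booster on Fin order

module Booster (s : ℕ) where

  open Construction s

  Grid : Set
  Grid = Fin q × Fin q × Fin (suc s) × Fin (suc s)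

  Code : Set
  Code = (Fin q × Fin q) ⊎ Fin q ⊎ Grid ⊎ Grid

  code : Vertex → Code
  code (hub (mat a b))                  = inj₁ (a , b)
  code (hub (ext a))                    = inj₂ (inj₁ a)
  code (cell (gadget diagonal u v) r c) = inj₂ (inj₂ (inj₁ (u , v , r , c)))
  code (cell (gadget external u v) r c) = inj₂ (inj₂ (inj₂ (u , v , r , c)))

  uncode : Code → Vertex
  uncode (inj₁ (a , b))                       = hub (mat a b)
  uncode (inj₂ (inj₁ a))                      = hub (ext a)
  uncode (inj₂ (inj₂ (inj₁ (u , v , r , c)))) = cell (gadget diagonal u v) r c
  uncode (inj₂ (inj₂ (inj₂ (u , v , r , c)))) = cell (gadget external u v) r c

  uncode-code : ∀ w → uncode (code w) ≡ w
  uncode-code (hub (mat _ _))                  = refl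
  uncode-code (hub (ext _))                    = refl
  uncode-code (cell (gadget diagonal _ _) _ _) = refl
  uncode-code (cell (gadget external _ _) _ _) = refl

  G order : ℕ
  G     = q * (q * (suc s * suc s))
  order = q * q + (q + (G + G))

  Fin↔Code : Fin order ↔ Code
  Fin↔Code = (*↔× ⊎-↔ ((↔-refl ⊎-↔ ((Fin↔Grid ⊎-↔ Fin↔Grid) ↔-∘ +↔⊎)) ↔-∘ +↔⊎)) ↔-∘ +↔⊎
    where
    Fin↔Grid : Fin G ↔ Grid
    Fin↔Grid = (↔-refl ×-↔ ((↔-refl ×-↔ *↔×) ↔-∘ *↔×)) ↔-∘ *↔×

  encode : Vertex → Fin order
  encode = Inverse.from Fin↔Code ∘ code

  decode : Fin order → Vertex
  decode = uncode ∘ Inverse.to Fin↔Code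

  decode-encode : ∀ w → decode (encode w) ≡ w
  decode-encode w = trans (cong uncode (Inverse.strictlyInverseˡ Fin↔Code (code w))) (uncode-code w)

  encode-injective : Injective _≡_ _≡_ encode
  encode-injective {w} {w′} e = begin
    w                  ≡⟨ decode-encode w ⟨
    decode (encode w)  ≡⟨ cong decode e ⟩
    decode (encode w′) ≡⟨ decode-encode w′ ⟩
    w′                 ∎
    where open ≡-Reasoning

  clique privatePart : Side → Clique → Subset order
  clique      sd i = image (encode ∘ vertex sd i)
  privatePart sd i = image (encode ∘ privateVertex sd i)

  root : Subset order
  root = clique bullet apex

  ∈-clique⁺ : ∀ sd i {w} → w ∈[ sd ] i → encode w ∈ clique sd i
  ∈-clique⁺ sd i (p , refl) = ∈-image⁺ (encode ∘ vertex sd i) p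

  ∈-clique⁻ : ∀ sd i {x} → x ∈ clique sd i → ∃[ w ] (w ∈[ sd ] i × encode w ≡ x)
  ∈-clique⁻ sd i x∈i with ∈-image⁻ (encode ∘ vertex sd i) x∈i
  ... | p , refl = vertex sd i p , (p , refl) , refl

  encode∈clique⁻ : ∀ sd i {w} → encode w ∈ clique sd i → w ∈[ sd ] i
  encode∈clique⁻ sd i w∈i with ∈-clique⁻ sd i w∈i
  ... | w′ , w′∈i , e = ≡.subst (_∈[ sd ] i) (encode-injective e) w′∈i

  cliqueEdge⁺ : ∀ sd i {w₁ w₂} → w₁ ∈[ sd ] i → w₂ ∈[ sd ] i → w₁ ≢ w₂ →
                CliqueEdge (clique sd i) (encode w₁) (encode w₂)
  cliqueEdge⁺ sd i w₁∈i w₂∈i w₁≢w₂ = ∈-clique⁺ sd i w₁∈i , ∈-clique⁺ sd i w₂∈i , w₁≢w₂ ∘ encode-injective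

  cliqueEdge⁻ : ∀ sd i {x y} → CliqueEdge (clique sd i) x y →
                ∃[ w₁ ] ∃[ w₂ ] (encode w₁ ≡ x × encode w₂ ≡ y × w₁ ∈[ sd ] i × w₂ ∈[ sd ] i × w₁ ≢ w₂)
  cliqueEdge⁻ sd i (x∈i , y∈i , x≢y) with ∈-clique⁻ sd i x∈i | ∈-clique⁻ sd i y∈i
  ... | w₁ , w₁∈i , refl | w₂ , w₂∈i , refl = w₁ , w₂ , refl , refl , w₁∈i , w₂∈i , x≢y ∘ cong encode

  ∣clique∣≡q : ∀ sd i → Valid i → ∣ clique sd i ∣ ≡ q
  ∣clique∣≡q sd i vi = ∣image∣≡k (encode ∘ vertex sd i) (vertex-injective sd i vi ∘ encode-injective)

  clique-edgeDisjoint : ∀ sd {i j} → Valid i → Valid j → i ≢ j → EdgeDisjoint (clique sd i) (clique sd j)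
  clique-edgeDisjoint sd {i} {j} vi vj i≢j x y x–y∈i (x∈j , y∈j , _) with cliqueEdge⁻ sd i x–y∈i
  ... | w₁ , w₂ , refl , refl , w₁∈i , w₂∈i , w₁≢w₂ =
    i≢j (sharedEdge⇒≡ sd vi vj w₁≢w₂ w₁∈i w₂∈i (encode∈clique⁻ sd j x∈j) (encode∈clique⁻ sd j y∈j))

  privatePart⊆clique : ∀ sd i → privatePart sd i ⊆ clique sd i
  privatePart⊆clique sd i x∈ with ∈-image⁻ (encode ∘ privateVertex sd i) x∈
  ... | p , refl = ∈-clique⁺ sd i (suc (suc p) , refl)

  privatePart#root : ∀ sd i → Listed sd i → Disjoint (privatePart sd i) root
  privatePart#root sd i li x∈i x∈root
    with ∈-image⁻ (encode ∘ privateVertex sd i) x∈i | ∈-clique⁻ bullet apex x∈root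
  ... | p , refl | _ , (a , refl) , e = privateVertex≢root sd i li p a (encode-injective (≡.sym e))

  ∣privatePart∣≡s : ∀ sd i → Valid i → ∣ privatePart sd i ∣ ≡ s
  ∣privatePart∣≡s sd i vi = ∣image∣≡k (encode ∘ privateVertex sd i)
    (FP.suc-injective ∘ FP.suc-injective ∘ vertex-injective sd i vi ∘ encode-injective)

  privateParts-disjoint : ∀ sd {i j} → Listed sd i → Listed sd j → i ≢ j → isColumn i ≡ isColumn j →
                          Disjoint (privatePart sd i) (privatePart sd j)
  privateParts-disjoint sd {i} {j} li lj i≢j same x∈i x∈j
    with ∈-image⁻ (encode ∘ privateVertex sd i) x∈i | ∈-image⁻ (encode ∘ privateVertex sd j) x∈j
  ... | p , e | p′ , e′ = i≢j (begin
    i                                                  ≡⟨ privateOwner-correct sd i li p ⟨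
    privateOwner (isColumn i) (privateVertex sd i p)   ≡⟨ cong₂ privateOwner same (encode-injective (trans e (≡.sym e′))) ⟩
    privateOwner (isColumn j) (privateVertex sd j p′)  ≡⟨ privateOwner-correct sd j lj p′ ⟩
    j                                                  ∎)
    where open ≡-Reasoning

  decomposition : Side → List (Subset order)
  decomposition sd = map (clique sd) (cliques sd)

  cliques-listed : ∀ sd → All (Listed sd) (cliques sd)
  cliques-listed sd = all-filter (listed? sd) allCliques

  ∈-decomposition⁺ : ∀ sd i → Listed sd i → clique sd i ∈ₗ decomposition sd
  ∈-decomposition⁺ sd i li = ∈-map⁺ (clique sd) (∈-cliques⁺ sd i li)

  ∈-decomposition⁻ : ∀ sd {H} → H ∈ₗ decomposition sd → ∃[ i ] (Listed sd i × H ≡ clique sd i)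
  ∈-decomposition⁻ sd H∈ with ∈-map⁻ (clique sd) H∈
  ... | i , i∈ , refl = i , ∈-cliques⁻ sd i∈ , refl

  ∣decomposition∣≡q : ∀ sd → All (λ H → ∣ H ∣ ≡ q) (decomposition sd)
  ∣decomposition∣≡q sd =
    AllP.map⁺ (All.map (λ {i} li → ∣clique∣≡q sd i (listed⇒valid sd li)) (cliques-listed sd))

  decomposition-edgeDisjoint : ∀ sd → AllPairs EdgeDisjoint (decomposition sd)
  decomposition-edgeDisjoint sd = AllPairsP.map⁺
    (Unique⇒AllPairs (λ li lj → clique-edgeDisjoint sd (listed⇒valid sd li) (listed⇒valid sd lj))
                     (cliques-listed sd) (cliques-unique sd))

  boosterGraph : Graph order
  boosterGraph = cliqueGraph (decomposition bullet)

  bulletEdge∈graph : ∀ {j w₁ w₂} → Valid j → w₁ ∈[ bullet ] j → w₂ ∈[ bullet ] j → w₁ ≢ w₂ →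
                     Adj (boosterGraph ∪K root) (encode w₁) (encode w₂)
  bulletEdge∈graph {apex}         _  w₁∈ w₂∈ w₁≢w₂ = inj₂ (cliqueEdge⁺ bullet apex w₁∈ w₂∈ w₁≢w₂)
  bulletEdge∈graph {j@(line _ _ _)} vj w₁∈ w₂∈ w₁≢w₂ =
    inj₁ (clique bullet j , ∈-decomposition⁺ bullet j (vj , λ ()) , cliqueEdge⁺ bullet j w₁∈ w₂∈ w₁≢w₂)
  bulletEdge∈graph {j@(mrow _)}     vj w₁∈ w₂∈ w₁≢w₂ =
    inj₁ (clique bullet j , ∈-decomposition⁺ bullet j (vj , λ ()) , cliqueEdge⁺ bullet j w₁∈ w₂∈ w₁≢w₂)

  circ-covers : ∀ {w₁ w₂} → CoveredOn circ w₁ w₂ → w₁ ≢ w₂ →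
                ∃[ H ] (H ∈ₗ decomposition circ × CliqueEdge H (encode w₁) (encode w₂))
  circ-covers (i , vi , w₁∈ , w₂∈) w₁≢w₂ =
    clique circ i , ∈-decomposition⁺ circ i vi , cliqueEdge⁺ circ i w₁∈ w₂∈ w₁≢w₂

  circ-decomposition : IsKqDecomposition q (boosterGraph ∪K root) (decomposition circ)
  circ-decomposition = All.tabulate isCopy , decomposition-edgeDisjoint circ , covers
    where
    isCopy : ∀ {H} → H ∈ₗ decomposition circ → IsKqCopyIn q (boosterGraph ∪K root) H
    isCopy H∈ with ∈-decomposition⁻ circ H∈
    ... | i , vi , refl = ∣clique∣≡q circ i vi , edges
      where
      edges : ∀ x y → CliqueEdge (clique circ i) x y → Adj (boosterGraph ∪K root) x y
      edges x y x–y with cliqueEdge⁻ circ i x–y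
      ... | w₁ , w₂ , refl , refl , w₁∈ , w₂∈ , w₁≢w₂ with edge-covered circ i vi w₁≢w₂ w₁∈ w₂∈
      ... | j , vj , w₁∈j , w₂∈j = bulletEdge∈graph vj w₁∈j w₂∈j w₁≢w₂
    covers : ∀ x y → Adj (boosterGraph ∪K root) x y → ∃[ H ] (H ∈ₗ decomposition circ × CliqueEdge H x y)
    covers x y (inj₁ (H , H∈ , x–y)) with ∈-decomposition⁻ bullet H∈
    ... | j , (vj , _) , refl with cliqueEdge⁻ bullet j x–y
    ... | w₁ , w₂ , refl , refl , w₁∈ , w₂∈ , w₁≢w₂ =
      circ-covers (edge-covered bullet j vj w₁≢w₂ w₁∈ w₂∈) w₁≢w₂
    covers x y (inj₂ x–y) with cliqueEdge⁻ bullet apex x–y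
    ... | w₁ , w₂ , refl , refl , w₁∈ , w₂∈ , w₁≢w₂ =
      circ-covers (edge-covered bullet apex tt w₁≢w₂ w₁∈ w₂∈) w₁≢w₂

  root-disjoint : ∀ x y → CliqueEdge root x y → ¬ Adj boosterGraph x y
  root-disjoint x y x–y (H , H∈ , (x∈H , y∈H , _))
    with ∈-decomposition⁻ bullet H∈ | cliqueEdge⁻ bullet apex x–y
  ... | j , (vj , j≢apex) , refl | w₁ , w₂ , refl , refl , w₁∈ , w₂∈ , w₁≢w₂ =
    j≢apex (sharedEdge⇒≡ bullet vj tt w₁≢w₂ (encode∈clique⁻ bullet j x∈H) (encode∈clique⁻ bullet j y∈H) w₁∈ w₂∈)

  root∉circ : Fin s → ¬ (root ∈ₗ decomposition circ)
  root∉circ p root∈ with ∈-decomposition⁻ circ root∈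
  ... | i , vi , root≡i = privatePart#root circ i vi x∈T (≡.subst (x ∈_) (≡.sym root≡i) (privatePart⊆clique circ i x∈T))
    where
    x   = encode (privateVertex circ i p)
    x∈T = ∈-image⁺ (encode ∘ privateVertex circ i) p

  density : ∀ sd → MaxRootedDensity≤ (decomposition sd) root 2 s
  density sd = maxRootedDensity≤2/t (clique sd) (privatePart sd) root isColumn (cliques sd)
    (All.tabulate (λ {i} _ {x} → privatePart⊆clique sd i {x}))
    (All.map (λ {i} li {x} → privatePart#root sd i li {x}) (cliques-listed sd))
    (All.map (λ {i} li → ∣privatePart∣≡s sd i (listed⇒valid sd li)) (cliques-listed sd))
    (Unique⇒AllPairs (privateParts-disjoint sd) (cliques-listed sd) (cliques-unique sd))

  booster : Fin s → RootedBooster q order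
  booster p = record
    { B           = boosterGraph
    ; Bcirc       = decomposition circ
    ; Bbullet     = decomposition bullet
    ; R           = root
    ; R-size      = ∣clique∣≡q bullet apex tt
    ; R-disjoint  = root-disjoint
    ; Bbullet-dec = cliqueGraph-decomposition (∣decomposition∣≡q bullet) (decomposition-edgeDisjoint bullet)
    ; Bcirc-dec   = circ-decomposition
    ; R∉Bcirc     = root∉circ p
    }

lemma4p4 : ∀ (q : ℕ) → 2 < q → ∃[ n ] Σ (RootedBooster q n) (λ 𝓑 → RootedDensity≤ 𝓑 2 (q ∸ 2))
lemma4p4 (suc (suc (suc s))) _ = order , booster zero , density circ , density bullet
  where
  open Construction (suc s) using (circ; bullet)
  open Booster (suc s)
lemma4p4 (suc zero)       (s≤s ())
lemma4p4 (suc (suc zero)) (s≤s (s≤s ()))
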